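{- Let $\mathbf A$ be an $\iota$-near semiring, $e$ a central element of $\mathbf A$, and $a,b\in A$. Then (1) $e\cdot e=e$; (2) $e\cdot a=a\cdot e$; (3) $(e\cdot a)\cdot b=a\cdot(e\cdot b)$.
   Context: An $\iota$-near semiring is an algebra $\mathbf A=\langle A,+,\cdot,{}^{\alpha},0,1\rangle$ of type $\langle 2,2,1,0,0\rangle$ such that $\langle A,+\rangle$ is a join semilattice with least element $0$ and greatest element $1$ (order $x\le y$ iff $x+y=y$), $x\cdot1=x=1\cdot x$, $(x+y)\cdot z=xz+yz$, $x0=0x=0$, $(x^{\alpha})^{\alpha}=x$, and $x\le y$ implies $y^{\alpha}\le x^{\alpha}$. An element $e\in A$ is central if the principal congruences $\theta(e,0)$ and $\theta(e,1)$ form a pair of factor congruences: $\theta(e,0)\cap\theta(e,1)$ is the identity relation and $\theta(e,0)\circ\theta(e,1)=A\times A$. -}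

module Defs where

open import Level using (Level; suc; _⊔_)
open import Relation.Binary.PropositionalEquality using (_≡_)
open import Data.Product using (Σ; _×_; ∃)

record IotaNearSemiring (a : Level) : Set (suc a) where
  infixl 6 _+_
  infixl 7 _·_
  field
    Carrier : Set a
    _+_     : Carrier → Carrier → Carrier
    _·_     : Carrier → Carrier → Carrier
    _ᵅ      : Carrier → Carrier
    𝟘       : Carrier
    𝟙       : Carrier
    +-assoc : ∀ x y z → (x + y) + z ≡ x + (y + z)
    +-comm  : ∀ x y → x + y ≡ y + x
    +-idem  : ∀ x → x + x ≡ x
    𝟘-least    : ∀ x → 𝟘 + x ≡ x
    𝟙-greatest : ∀ x → x + 𝟙 ≡ 𝟙
    ·-identityʳ : ∀ x → x · 𝟙 ≡ x
    ·-identityˡ : ∀ x → 𝟙 · x ≡ x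
    distribʳ    : ∀ x y z → (x + y) · z ≡ x · z + y · z
    zeroʳ       : ∀ x → x · 𝟘 ≡ 𝟘
    zeroˡ       : ∀ x → 𝟘 · x ≡ 𝟘
    ᵅ-invol     : ∀ x → (x ᵅ) ᵅ ≡ x
    ᵅ-antitone  : ∀ x y → x + y ≡ y → (y ᵅ) + (x ᵅ) ≡ (x ᵅ)

  _≤_ : Carrier → Carrier → Set a
  x ≤ y = x + y ≡ y

module _ {a : Level} (A : IotaNearSemiring a) where
  open IotaNearSemiring A

  -- Principal congruence θ(u,v): the least congruence of A containing (u,v),
  -- generated inductively (equivalence + compatibility with +, ·, α).
  data θ (u v : Carrier) : Carrier → Carrier → Set a where
    gen   : θ u v u v
    refl  : ∀ {x} → θ u v x x
    sym   : ∀ {x y} → θ u v x y → θ u v y x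
    trans : ∀ {x y z} → θ u v x y → θ u v y z → θ u v x z
    +-cong : ∀ {x x′ y y′} → θ u v x x′ → θ u v y y′ → θ u v (x + y) (x′ + y′)
    ·-cong : ∀ {x x′ y y′} → θ u v x x′ → θ u v y y′ → θ u v (x · y) (x′ · y′)
    ᵅ-cong : ∀ {x y} → θ u v x y → θ u v (x ᵅ) (y ᵅ)

  -- e is central: θ(e,0) and θ(e,1) are a pair of factor congruences.
  Central : Carrier → Set a
  Central e =
    (∀ x y → θ e 𝟘 x y → θ e 𝟙 x y → x ≡ y)
    × (∀ x y → ∃ λ z → θ e 𝟘 x z × θ e 𝟙 z y)

module Submission where

-- If e is central, θ(e,0) ∩ θ(e,1) is the identity, so two elements
-- are equal as soon as they are related both by θ(e,0) and by θ(e,1).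
-- Any unary polynomial p of A is compatible with every principal congruence,
-- hence θ(e,c) relates p(e) to p(c).  Consequently two polynomials that agree
-- at 0 and at 1 agree at every central element e ("central elements are
-- determined by their behaviour at the constants 0 and 1").
--
-- Each of the three identities of
-- the theorem is then an instance for a pair of polynomials in e, checked at
-- 0 and 1 with the absorption and unit laws:
--   (1) x·x  vs x,   (2) x·a vs a·x,   (3) (x·a)·b vs a·(x·b).

open import Defs
open import Data.Product using (_×_; _,_)
open import Relation.Binary.PropositionalEquality as ≡ using (_≡_)
open import Level using (Level)

module CentralElements {ℓ : Level} (A : IotaNearSemiring ℓ) where
  open IotaNearSemiring A

  ≡⇒θ : ∀ {u v x y} → x ≡ y → θ A u v x y
  ≡⇒θ ≡.refl = refl

  Compatible : (Carrier → Carrier) → Set ℓ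
  Compatible f = ∀ {u v x y} → θ A u v x y → θ A u v (f x) (f y)

  -- Two compatible maps agreeing at 0 and at 1 agree at any central element:
  -- f e θ(e,c) f c = g c θ(e,c) g e for c ∈ {0,1}, and θ(e,0) ∩ θ(e,1) = Δ.
  agree-at-central : ∀ {e} → Central A e → (f g : Carrier → Carrier) →
    Compatible f → Compatible g → f 𝟘 ≡ g 𝟘 → f 𝟙 ≡ g 𝟙 → f e ≡ g e
  agree-at-central (separating , _) f g f-compat g-compat f0≡g0 f1≡g1 =
    separating (f _) (g _) (through f0≡g0) (through f1≡g1)
    where
    through : ∀ {e c} → f c ≡ g c → θ A e c (f e) (g e)
    through fc≡gc = trans (f-compat gen) (trans (≡⇒θ fc≡gc) (sym (g-compat gen)))

  central-idempotent : ∀ {e} → Central A e → e · e ≡ e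
  central-idempotent central =
    agree-at-central central (λ x → x · x) (λ x → x)
      (λ h → ·-cong h h) (λ h → h) (zeroʳ 𝟘) (·-identityʳ 𝟙)

  central-commutes : ∀ {e} → Central A e → ∀ a → e · a ≡ a · e
  central-commutes central a =
    agree-at-central central (λ x → x · a) (λ x → a · x)
      (λ h → ·-cong h refl) (λ h → ·-cong refl h)
      (≡.trans (zeroˡ a) (≡.sym (zeroʳ a)))
      (≡.trans (·-identityˡ a) (≡.sym (·-identityʳ a)))

  central-shift : ∀ {e} → Central A e → ∀ a b → (e · a) · b ≡ a · (e · b)
  central-shift central a b =
    agree-at-central central (λ x → (x · a) · b) (λ x → a · (x · b))
      (λ h → ·-cong (·-cong h refl) refl) (λ h → ·-cong refl (·-cong h refl))
      at-𝟘 at-𝟙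
    where
    open ≡.≡-Reasoning
    at-𝟘 : (𝟘 · a) · b ≡ a · (𝟘 · b)
    at-𝟘 = begin
      (𝟘 · a) · b  ≡⟨ ≡.cong (_· b) (zeroˡ a) ⟩
      𝟘 · b        ≡⟨ zeroˡ b ⟩
      𝟘            ≡⟨ ≡.sym (zeroʳ a) ⟩
      a · 𝟘        ≡⟨ ≡.cong (a ·_) (≡.sym (zeroˡ b)) ⟩
      a · (𝟘 · b)  ∎
    at-𝟙 : (𝟙 · a) · b ≡ a · (𝟙 · b)
    at-𝟙 = begin
      (𝟙 · a) · b  ≡⟨ ≡.cong (_· b) (·-identityˡ a) ⟩
      a · b        ≡⟨ ≡.cong (a ·_) (≡.sym (·-identityˡ b)) ⟩
      a · (𝟙 · b)  ∎

lemma3 : {ℓ : Level} (A : IotaNearSemiring ℓ) →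
    let open IotaNearSemiring A in
    (e : Carrier) → Central A e → (a b : Carrier) →
    (e · e ≡ e) × (e · a ≡ a · e) × ((e · a) · b ≡ a · (e · b))
lemma3 A e central a b =
  central-idempotent central , central-commutes central a , central-shift central a b
  where open CentralElements A
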